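{- For every $w\in S_n$, $c(w)=\mathrm{dep}(w^{ -1})$.
   Context: For $w\in S_n$, let $D_L(w)=\{i\in\{1,\dots,n-1\}: w^{ -1}(i+1)<w^{ -1}(i)\}$. Define $c_1(w)=0$ and, for $2\le i\le n$, $c_i(w)=c_{i-1}(w)$ if $i-1\notin D_L(w)$ and $c_i(w)=c_{i-1}(w)+1$ otherwise; set $c(w)=\sum_{i=1}^nc_i(w)$ (the charge statistic). For a composition $\alpha=(\alpha_1,\dots,\alpha_l)$, $\mathrm{dep}(\alpha)=\sum_{i=1}^l(i-1)\alpha_i$. For a standard Young tableau $T$ with $n$ boxes, $\mathrm{Des}\,T=\{i: i+1 \text{ lies in a row strictly below the row of } i\}$; if $\mathrm{Des}\,T=\{a_1<\dots<a_k\}$, $\mathrm{des}\,T=(a_1,a_2-a_1,\dots,a_k-a_{k-1},n-a_k)$. For $v\in S_n$, $Q(v)$ is the Robinson–Schensted recording tableau of $v$ and $\mathrm{dep}(v):=\mathrm{dep}(\mathrm{des}\,Q(v))$. -}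

module Defs where

open import Data.Nat using (ℕ; zero; suc; _+_; _*_; _∸_; _<ᵇ_; _<?_)
open import Data.Bool using (Bool; true; false; if_then_else_)
open import Data.Fin using (Fin; toℕ)
open import Data.Fin.Permutation using (Permutation′; _⟨$⟩ʳ_; _⟨$⟩ˡ_; flip)
open import Data.Nat.ListAction using (sum)
open import Data.List using (List; []; _∷_; map; upTo; allFin; filter; [_])
open import Data.Maybe using (Maybe; just; nothing; maybe)
open import Data.Product using (_×_; _,_)

finOf : (n : ℕ) → ℕ → Maybe (Fin n)
finOf zero    _       = nothing
finOf (suc n) zero    = just Data.Fin.zero
finOf (suc n) (suc i) = maybe (λ j → just (Data.Fin.suc j)) nothing (finOf n i)

oneTo : ℕ → List ℕ
oneTo m = map suc (upTo m)

-- Permutations in S_n are Permutation′ n (bijections Fin n ↔ Fin n).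
-- Values/positions are 1-indexed in the paper: value i ∈ {1..n} is the
-- element of Fin n with toℕ = i - 1.

inv : ∀ {n} → Permutation′ n → Permutation′ n
inv = flip

-- w⁻¹(i) (as a 0-indexed natural number), for 1 ≤ i ≤ n
invAt : ∀ {n} → Permutation′ n → ℕ → ℕ
invAt {n} w i = maybe (λ j → toℕ (w ⟨$⟩ˡ j)) 0 (finOf n (i ∸ 1))

inDL : ∀ {n} → Permutation′ n → ℕ → Bool
inDL w i = invAt w (suc i) <ᵇ invAt w i

chargeAt : ∀ {n} → Permutation′ n → ℕ → ℕ
chargeAt w zero          = 0
chargeAt w (suc zero)    = 0
chargeAt w (suc (suc k)) =
  chargeAt w (suc k) + (if inDL w (suc k) then 1 else 0)

charge : ∀ {n} → Permutation′ n → ℕ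
charge {n} w = sum (map (chargeAt w) (oneTo n))

depFrom : ℕ → List ℕ → ℕ
depFrom k []       = 0
depFrom k (a ∷ as) = k * a + depFrom (suc k) as

depComp : List ℕ → ℕ
depComp α = depFrom 0 α

-- a tableau is a list of rows (top row first), each row left to right
Tableau : Set
Tableau = List (List ℕ)

rowInsert : ℕ → List ℕ → Maybe ℕ × List ℕ
rowInsert x []       = nothing , x ∷ []
rowInsert x (y ∷ ys) with x <ᵇ y
... | true  = just y , x ∷ ys
... | false with rowInsert x ys
...   | b , ys' = b , y ∷ ys'

-- Schensted insertion of x into P; also returns the (0-indexed) row in
-- which the new box was created
insertP : ℕ → Tableau → Tableau × ℕ
insertP x []       = (x ∷ []) ∷ [] , 0
insertP x (r ∷ rs) with rowInsert x r
... | nothing , r' = r' ∷ rs , 0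
... | just y  , r' with insertP y rs
...   | rs' , k = r' ∷ rs' , suc k

addAt : ℕ → ℕ → Tableau → Tableau
addAt zero    m []       = (m ∷ []) ∷ []
addAt (suc k) m []       = (m ∷ []) ∷ []
addAt zero    m (r ∷ rs) = (r Data.List.++ [ m ]) ∷ rs
addAt (suc k) m (r ∷ rs) = r ∷ addAt k m rs

rsFrom : ℕ → Tableau → Tableau → List ℕ → Tableau × Tableau
rsFrom lbl P Q []       = P , Q
rsFrom lbl P Q (x ∷ xs) with insertP x P
... | P' , k = rsFrom (suc lbl) P' (addAt k lbl Q) xs

-- one-line word v(1) v(2) ... v(n) (values 0-indexed; order is all that matters)
word : ∀ {n} → Permutation′ n → List ℕ
word {n} v = map (λ i → toℕ (v ⟨$⟩ʳ i)) (allFin n)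

-- recording tableau Q(v), with entries 1..n
recQ : ∀ {n} → Permutation′ n → Tableau
recQ v with rsFrom 1 [] [] (word v)
... | _ , Q = Q

memRow : ℕ → List ℕ → Bool
memRow m []       = false
memRow m (x ∷ xs) with Data.Nat._≡ᵇ_ m x
... | true  = true
... | false = memRow m xs

-- (0-indexed) row containing entry m (defaults past the last row)
rowOf : ℕ → Tableau → ℕ
rowOf m []       = 0
rowOf m (r ∷ rs) = if memRow m r then 0 else suc (rowOf m rs)

Des : ℕ → Tableau → List ℕ
Des n T = filter (λ i → rowOf i T <? rowOf (suc i) T) (oneTo (n ∸ 1))

desFrom : ℕ → ℕ → List ℕ → List ℕ
desFrom n prev []       = [ n ∸ prev ]
desFrom n prev (a ∷ as) = (a ∸ prev) ∷ desFrom n a as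

des : ℕ → Tableau → List ℕ
des n T = desFrom n 0 (Des n T)

depPerm : ∀ {n} → Permutation′ n → ℕ
depPerm {n} v = depComp (des n (recQ v))

-- By the row bumping lemma, inserting x and then y into a tableau creates the
-- second box weakly above the first when x ≤ y and strictly below it when y < x.
-- Hence i ∈ Des Q(v) exactly when v(i+1) < v(i), which for v = w⁻¹ says
-- i ∈ D_L(w). Both sides then depend only on D = D_L(w): c_i(w) = #{d ∈ D : d < i},
-- and the index i lies in block #{d ∈ D : d < i} + 1 of des Q(v), so
-- dep(w⁻¹) is the same sum.
module Submission where

open import Defs
open import Data.Nat using (ℕ)
open import Data.Fin.Permutation using (Permutation′)
open import Relation.Binary.PropositionalEquality using (_≡_)

open import Data.Nat using (zero; suc; _+_; _*_; _∸_; _<ᵇ_; _≡ᵇ_; _<?_; _≤_; _<_; z≤n; s≤s)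
open import Data.Nat.Properties
open import Data.Nat.ListAction using (sum)
open import Data.Bool using (Bool; true; false; T; if_then_else_)
open import Data.Fin as Fin using (Fin; toℕ)
open import Data.Fin.Permutation using (_⟨$⟩ʳ_)
open import Data.List using (List; []; _∷_; [_]; _++_; length; map; filter; tabulate; applyUpTo)
open import Data.List.Properties using (map-tabulate; length-tabulate; map-upTo)
open import Data.List.Relation.Unary.All as All using (All; []; _∷_)
import Data.List.Relation.Unary.All.Properties as AllP
open import Data.List.Relation.Unary.AllPairs using (AllPairs; []; _∷_)
open import Data.Maybe using (Maybe; just; nothing; maybe)
import Data.Maybe.Relation.Unary.All as Maybe
open import Data.Product using (_,_; proj₁; proj₂; map₂)
open import Function using (_∘_)
open import Relation.Binary.PropositionalEquality
  using (_≢_; refl; sym; trans; cong; cong₂; subst; module ≡-Reasoning)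
open import Relation.Nullary using (yes; no; does; contradiction)
open import Relation.Nullary.Decidable using (T?)
open import Relation.Unary using (Pred; Decidable)
open ≡-Reasoning

<ᵇ≡true⇒< : ∀ {m n} → (m <ᵇ n) ≡ true → m < n
<ᵇ≡true⇒< {m} {n} eq = <ᵇ⇒< m n (subst T (sym eq) _)

<ᵇ≡false⇒≥ : ∀ {m n} → (m <ᵇ n) ≡ false → n ≤ m
<ᵇ≡false⇒≥ eq = ≮⇒≥ (λ m<n → subst T eq (<⇒<ᵇ m<n))

<ᵇ-agree : ∀ {a b c d} → (c < d → a < b) → (d ≤ c → b ≤ a) → (a <ᵇ b) ≡ (c <ᵇ d)
<ᵇ-agree {a} {b} {c} {d} lt ge with c <ᵇ d in e | a <ᵇ b in e′
... | true  | true  = refl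
... | false | false = refl
... | true  | false = contradiction (lt (<ᵇ≡true⇒< e)) (≤⇒≯ (<ᵇ≡false⇒≥ e′))
... | false | true  = contradiction (<ᵇ≡true⇒< e′) (≤⇒≯ (ge (<ᵇ≡false⇒≥ e)))

filter-cong : ∀ {a p q} {A : Set a} {P : Pred A p} {Q : Pred A q} (P? : Decidable P) (Q? : Decidable Q) →
  ∀ {xs} → All (λ x → does (P? x) ≡ does (Q? x)) xs → filter P? xs ≡ filter Q? xs
filter-cong P? Q? []               = refl
filter-cong P? Q? {x ∷ xs} (eq ∷ eqs) rewrite eq with does (Q? x)
... | true  = cong (x ∷_) (filter-cong P? Q? eqs)
... | false = filter-cong P? Q? eqs

rowInsert-< : ∀ {x z zs} → x < z → rowInsert x (z ∷ zs) ≡ (just z , x ∷ zs)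
rowInsert-< {x} {z} x<z with x <ᵇ z in e
... | true  = refl
... | false = contradiction x<z (≤⇒≯ (<ᵇ≡false⇒≥ e))

rowInsert-≥ : ∀ {x z zs} → z ≤ x → rowInsert x (z ∷ zs) ≡ map₂ (z ∷_) (rowInsert x zs)
rowInsert-≥ {x} {z} z≤x with x <ᵇ z in e
... | true  = contradiction (<ᵇ≡true⇒< e) (≤⇒≯ z≤x)
... | false = refl

rowInsert-bumped> : ∀ x r → Maybe.All (x <_) (proj₁ (rowInsert x r))
rowInsert-bumped> x []       = Maybe.nothing
rowInsert-bumped> x (z ∷ zs) with x <? z
... | yes x<z rewrite rowInsert-< {zs = zs} x<z = Maybe.just x<z
... | no  x≮z rewrite rowInsert-≥ {zs = zs} (≮⇒≥ x≮z) = rowInsert-bumped> x zs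

rowInsert-bumped∈ : ∀ {P : ℕ → Set} x r → All P r → Maybe.All P (proj₁ (rowInsert x r))
rowInsert-bumped∈ x []       []         = Maybe.nothing
rowInsert-bumped∈ x (z ∷ zs) (pz ∷ pzs) with x <? z
... | yes x<z rewrite rowInsert-< {zs = zs} x<z = Maybe.just pz
... | no  x≮z rewrite rowInsert-≥ {zs = zs} (≮⇒≥ x≮z) = rowInsert-bumped∈ x zs pzs

rowInsert-All : ∀ {P : ℕ → Set} x r → P x → All P r → All P (proj₂ (rowInsert x r))
rowInsert-All x []       px []         = px ∷ []
rowInsert-All x (z ∷ zs) px (pz ∷ pzs) with x <? z
... | yes x<z rewrite rowInsert-< {zs = zs} x<z = px ∷ pzs
... | no  x≮z rewrite rowInsert-≥ {zs = zs} (≮⇒≥ x≮z) = pz ∷ rowInsert-All x zs px pzs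

rowInsert-sorted : ∀ x r → AllPairs _≤_ r → AllPairs _≤_ (proj₂ (rowInsert x r))
rowInsert-sorted x []       []             = [] ∷ []
rowInsert-sorted x (z ∷ zs) (z≤zs ∷ sorted) with x <? z
... | yes x<z rewrite rowInsert-< {zs = zs} x<z = All.map (≤-trans (<⇒≤ x<z)) z≤zs ∷ sorted
... | no  x≮z rewrite rowInsert-≥ {zs = zs} (≮⇒≥ x≮z) =
  rowInsert-All x zs (≮⇒≥ x≮z) z≤zs ∷ rowInsert-sorted x zs sorted

-- A bumped entry is compared with `nothing` (no entry bumped) read as +∞.
data _≤∞_ : Maybe ℕ → Maybe ℕ → Set where
  ≤∞-top  : ∀ {b} → b ≤∞ nothing
  ≤∞-just : ∀ {b b′} → b ≤ b′ → just b ≤∞ just b′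

data _<∞_ : Maybe ℕ → Maybe ℕ → Set where
  <∞-top  : ∀ {b} → just b <∞ nothing
  <∞-just : ∀ {b b′} → b < b′ → just b <∞ just b′

All≤⇒≤∞ : ∀ {z b} → Maybe.All (z ≤_) b → just z ≤∞ b
All≤⇒≤∞ Maybe.nothing      = ≤∞-top
All≤⇒≤∞ (Maybe.just z≤b) = ≤∞-just z≤b

All<⇒<∞ : ∀ {z b} → Maybe.All (z <_) b → just z <∞ b
All<⇒<∞ Maybe.nothing      = <∞-top
All<⇒<∞ (Maybe.just z<b) = <∞-just z<b

rowBumping-≤ : ∀ x y r → x ≤ y → AllPairs _≤_ r →
  proj₁ (rowInsert x r) ≤∞ proj₁ (rowInsert y (proj₂ (rowInsert x r)))
rowBumping-≤ x y []       x≤y [] rewrite rowInsert-≥ {zs = []} x≤y = ≤∞-top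
rowBumping-≤ x y (z ∷ zs) x≤y (z≤zs ∷ sorted) with x <? z
... | yes x<z rewrite rowInsert-< {zs = zs} x<z | rowInsert-≥ {zs = zs} x≤y =
  All≤⇒≤∞ (rowInsert-bumped∈ y zs z≤zs)
... | no  x≮z rewrite rowInsert-≥ {zs = zs} (≮⇒≥ x≮z)
                    | rowInsert-≥ {zs = proj₂ (rowInsert x zs)} (≤-trans (≮⇒≥ x≮z) x≤y) =
  rowBumping-≤ x y zs x≤y sorted

rowBumping-> : ∀ x y r → y < x →
  proj₁ (rowInsert y (proj₂ (rowInsert x r))) <∞ proj₁ (rowInsert x r)
rowBumping-> x y []       y<x rewrite rowInsert-< {zs = []} y<x = <∞-top
rowBumping-> x y (z ∷ zs) y<x with x <? z
... | yes x<z rewrite rowInsert-< {zs = zs} x<z | rowInsert-< {zs = zs} y<x = <∞-just x<z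
... | no  x≮z rewrite rowInsert-≥ {zs = zs} (≮⇒≥ x≮z) with y <? z
...   | yes y<z rewrite rowInsert-< {zs = proj₂ (rowInsert x zs)} y<z =
  All<⇒<∞ (Maybe.map (≤-<-trans (≮⇒≥ x≮z)) (rowInsert-bumped> x zs))
...   | no  y≮z rewrite rowInsert-≥ {zs = proj₂ (rowInsert x zs)} (≮⇒≥ y≮z) =
  rowBumping-> x y zs y<x

-- meaningful for k ≤ l
rowCountAfter : ℕ → ℕ → ℕ
rowCountAfter zero    zero    = 1
rowCountAfter zero    (suc l) = suc l
rowCountAfter (suc k) zero    = 1
rowCountAfter (suc k) (suc l) = suc (rowCountAfter k l)

insertP-row≤length : ∀ x P → proj₂ (insertP x P) ≤ length P
insertP-row≤length x []       = z≤n
insertP-row≤length x (r ∷ rs) with rowInsert x r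
... | nothing , _ = z≤n
... | just y  , _ with insertP y rs | insertP-row≤length y rs
...   | _ , _ | k≤l = s≤s k≤l

insertP-length : ∀ x P → length (proj₁ (insertP x P)) ≡ rowCountAfter (proj₂ (insertP x P)) (length P)
insertP-length x []       = refl
insertP-length x (r ∷ rs) with rowInsert x r
... | nothing , _ = refl
... | just y  , _ with insertP y rs | insertP-length y rs
...   | _ , _ | eq = cong suc eq

insertP-sorted : ∀ x P → All (AllPairs _≤_) P → All (AllPairs _≤_) (proj₁ (insertP x P))
insertP-sorted x []       []              = ([] ∷ []) ∷ []
insertP-sorted x (r ∷ rs) (sr ∷ srs) with rowInsert x r | rowInsert-sorted x r sr
... | nothing , _ | sr′ = sr′ ∷ srs
... | just y  , _ | sr′ with insertP y rs | insertP-sorted y rs srs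
...   | _ , _ | srs′ = sr′ ∷ srs′

insertP-row-≥ : ∀ x y P → All (AllPairs _≤_) P → x ≤ y →
  proj₂ (insertP y (proj₁ (insertP x P))) ≤ proj₂ (insertP x P)
insertP-row-≥ x y [] [] x≤y with rowInsert y [ x ] | rowBumping-≤ x y [] x≤y []
... | nothing , _ | ≤∞-top = z≤n
insertP-row-≥ x y (r ∷ rs) (sr ∷ srs) x≤y with rowInsert x r | rowBumping-≤ x y r x≤y sr
... | nothing , r′ | bumps with rowInsert y r′ | bumps
...   | nothing , _ | ≤∞-top = z≤n
insertP-row-≥ x y (r ∷ rs) (sr ∷ srs) x≤y | just b , r′ | bumps with rowInsert y r′ | bumps
...   | nothing , _ | ≤∞-top = z≤n
...   | just b′ , _ | ≤∞-just b≤b′ with insertP b rs | insertP-row-≥ b b′ rs srs b≤b′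
...     | rs′ , _ | ih with insertP b′ rs′ | ih
...       | _ , _ | k′≤k = s≤s k′≤k

insertP-row-< : ∀ x y P → y < x →
  proj₂ (insertP x P) < proj₂ (insertP y (proj₁ (insertP x P)))
insertP-row-< x y [] y<x with rowInsert y [ x ] | rowBumping-> x y [] y<x
... | just _ , _ | <∞-top = s≤s z≤n
insertP-row-< x y (r ∷ rs) y<x with rowInsert x r | rowBumping-> x y r y<x
... | nothing , r′ | bumps with rowInsert y r′ | bumps
...   | just _ , _ | <∞-top = s≤s z≤n
insertP-row-< x y (r ∷ rs) y<x | just b , r′ | bumps with rowInsert y r′ | bumps
...   | just b′ , _ | <∞-just b′<b with insertP b rs | insertP-row-< b b′ rs b′<b
...     | rs′ , _ | ih with insertP b′ rs′ | ih
...       | _ , _ | k<k′ = s≤s k<k′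

-- rowOf m Q is length Q when m is absent, so this says that m occurs in Q.
Occurs : ℕ → Tableau → Set
Occurs m Q = rowOf m Q < length Q

memRow-∷ʳ-≢ : ∀ {m m′} r → m ≢ m′ → memRow m (r ++ [ m′ ]) ≡ memRow m r
memRow-∷ʳ-≢ {m} {m′} [] m≢m′ with m ≡ᵇ m′ in e
... | true  = contradiction (≡ᵇ⇒≡ m m′ (subst T (sym e) _)) m≢m′
... | false = refl
memRow-∷ʳ-≢ {m} (x ∷ r) m≢m′ with m ≡ᵇ x
... | true  = refl
... | false = memRow-∷ʳ-≢ r m≢m′

memRow-∷ʳ : ∀ m r → memRow m (r ++ [ m ]) ≡ true
memRow-∷ʳ m [] with m ≡ᵇ m | ≡⇒≡ᵇ m m refl
... | true | _ = refl
memRow-∷ʳ m (x ∷ r) with m ≡ᵇ x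
... | true  = refl
... | false = memRow-∷ʳ m r

memRow-All< : ∀ {m} r → All (_< m) r → memRow m r ≡ false
memRow-All< []      []           = refl
memRow-All< {m} (x ∷ r) (x<m ∷ r<m) with m ≡ᵇ x in e
... | true  = contradiction (≡ᵇ⇒≡ m x (subst T (sym e) _)) (>⇒≢ x<m)
... | false = memRow-All< r r<m

length-addAt : ∀ k m Q → length (addAt k m Q) ≡ rowCountAfter k (length Q)
length-addAt zero    m []       = refl
length-addAt (suc k) m []       = refl
length-addAt zero    m (r ∷ rs) = refl
length-addAt (suc k) m (r ∷ rs) = cong suc (length-addAt k m rs)

length-addAt-≥ : ∀ k m Q → length Q ≤ length (addAt k m Q)
length-addAt-≥ zero    m []       = z≤n
length-addAt-≥ (suc k) m []       = z≤n
length-addAt-≥ zero    m (r ∷ rs) = ≤-refl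
length-addAt-≥ (suc k) m (r ∷ rs) = s≤s (length-addAt-≥ k m rs)

rowOf-addAt-≢ : ∀ {m m′} k Q → m ≢ m′ → Occurs m Q → rowOf m (addAt k m′ Q) ≡ rowOf m Q
rowOf-addAt-≢ {m} zero (r ∷ rs) m≢m′ _ rewrite memRow-∷ʳ-≢ r m≢m′ = refl
rowOf-addAt-≢ {m} (suc k) (r ∷ rs) m≢m′ m∈Q with memRow m r
... | true  = refl
... | false = cong suc (rowOf-addAt-≢ k rs m≢m′ (≤-pred m∈Q))

Occurs-addAt-≢ : ∀ {m m′} k Q → m ≢ m′ → Occurs m Q → Occurs m (addAt k m′ Q)
Occurs-addAt-≢ k Q m≢m′ m∈Q rewrite rowOf-addAt-≢ k Q m≢m′ m∈Q =
  ≤-trans m∈Q (length-addAt-≥ k _ Q)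

rowOf-addAt-new : ∀ m k Q → k ≤ length Q → All (All (_< m)) Q → rowOf m (addAt k m Q) ≡ k
rowOf-addAt-new m zero    []       _         _          rewrite memRow-∷ʳ m [] = refl
rowOf-addAt-new m zero    (r ∷ rs) _         _          rewrite memRow-∷ʳ m r = refl
rowOf-addAt-new m (suc k) (r ∷ rs) (s≤s k≤l) (r<m ∷ rs<m) rewrite memRow-All< r r<m =
  cong suc (rowOf-addAt-new m k rs k≤l rs<m)

Occurs-addAt-new : ∀ m k Q → k ≤ length Q → All (All (_< m)) Q → Occurs m (addAt k m Q)
Occurs-addAt-new m k Q k≤l Q<m rewrite rowOf-addAt-new m k Q k≤l Q<m = row<length k Q k≤l
  where
  row<length : ∀ k Q → k ≤ length Q → k < length (addAt k m Q)
  row<length zero    []       _         = s≤s z≤n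
  row<length zero    (r ∷ rs) _         = s≤s z≤n
  row<length (suc k) (r ∷ rs) (s≤s k≤l) = s≤s (row<length k rs k≤l)

addAt-All< : ∀ m k Q → All (All (_< m)) Q → All (All (_< suc m)) (addAt k m Q)
addAt-All< m zero    []       []           = (≤-refl ∷ []) ∷ []
addAt-All< m (suc k) []       []           = (≤-refl ∷ []) ∷ []
addAt-All< m zero    (r ∷ rs) (r<m ∷ rs<m) =
  AllP.++⁺ (All.map m<n⇒m<1+n r<m) (≤-refl ∷ []) ∷ All.map (All.map m<n⇒m<1+n) rs<m
addAt-All< m (suc k) (r ∷ rs) (r<m ∷ rs<m) = All.map m<n⇒m<1+n r<m ∷ addAt-All< m k rs rs<m

-- the entry at position i, with junk value 0 out of range
nth : List ℕ → ℕ → ℕ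
nth []       _       = 0
nth (x ∷ xs) zero    = x
nth (x ∷ xs) (suc i) = nth xs i

insertionRows : Tableau → List ℕ → List ℕ
insertionRows P []       = []
insertionRows P (x ∷ xs) with insertP x P
... | P′ , k = k ∷ insertionRows P′ xs

rsFrom-rowOf-placed : ∀ xs lbl P Q m → m < lbl → Occurs m Q →
  rowOf m (proj₂ (rsFrom lbl P Q xs)) ≡ rowOf m Q
rsFrom-rowOf-placed []       lbl P Q m m<lbl m∈Q = refl
rsFrom-rowOf-placed (x ∷ xs) lbl P Q m m<lbl m∈Q with insertP x P
... | P′ , k = begin
  rowOf m (proj₂ (rsFrom (suc lbl) P′ (addAt k lbl Q) xs))
    ≡⟨ rsFrom-rowOf-placed xs (suc lbl) P′ (addAt k lbl Q) m (m<n⇒m<1+n m<lbl)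
         (Occurs-addAt-≢ k Q m≢lbl m∈Q) ⟩
  rowOf m (addAt k lbl Q)
    ≡⟨ rowOf-addAt-≢ k Q m≢lbl m∈Q ⟩
  rowOf m Q ∎
  where
  m≢lbl : m ≢ lbl
  m≢lbl = <⇒≢ m<lbl

rsFrom-rowOf : ∀ xs lbl P Q t → length P ≡ length Q → All (All (_< lbl)) Q → t < length xs →
  rowOf (lbl + t) (proj₂ (rsFrom lbl P Q xs)) ≡ nth (insertionRows P xs) t
rsFrom-rowOf (x ∷ xs) lbl P Q t lP≡lQ Q<lbl t<len
  with insertP x P | insertP-row≤length x P | insertP-length x P
... | P′ , k | k≤lP | lP′≡ with t
...   | zero rewrite +-identityʳ lbl = begin
  rowOf lbl (proj₂ (rsFrom (suc lbl) P′ (addAt k lbl Q) xs))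
    ≡⟨ rsFrom-rowOf-placed xs (suc lbl) P′ (addAt k lbl Q) lbl ≤-refl
         (Occurs-addAt-new lbl k Q k≤lQ Q<lbl) ⟩
  rowOf lbl (addAt k lbl Q)
    ≡⟨ rowOf-addAt-new lbl k Q k≤lQ Q<lbl ⟩
  k ∎
  where
  k≤lQ : k ≤ length Q
  k≤lQ = subst (k ≤_) lP≡lQ k≤lP
...   | suc t′ rewrite +-suc lbl t′ =
  rsFrom-rowOf xs (suc lbl) P′ (addAt k lbl Q) t′ lengths (addAt-All< lbl k Q Q<lbl) (≤-pred t<len)
  where
  lengths : length P′ ≡ length (addAt k lbl Q)
  lengths = trans lP′≡ (trans (cong (rowCountAfter k) lP≡lQ) (sym (length-addAt k lbl Q)))

insertionRows-descent : ∀ xs P t → All (AllPairs _≤_) P → suc t < length xs →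
  (nth (insertionRows P xs) t <ᵇ nth (insertionRows P xs) (suc t)) ≡ (nth xs (suc t) <ᵇ nth xs t)
insertionRows-descent (x ∷ []) P zero _ (s≤s ())
insertionRows-descent (x ∷ y ∷ xs) P zero P-sorted _
  with insertP x P | insertP-row-≥ x y P P-sorted | insertP-row-< x y P
... | P′ , k | row-≥ | row-< with insertP y P′ | row-≥ | row-<
...   | _ , k′ | k′≤k | k<k′ = <ᵇ-agree k<k′ k′≤k
insertionRows-descent (x ∷ xs) P (suc t) P-sorted t<len
  with insertP x P | insertP-sorted x P P-sorted
... | P′ , _ | P′-sorted = insertionRows-descent xs P′ t P′-sorted (≤-pred t<len)

recQ≡rsFrom : ∀ {n} (v : Permutation′ n) → recQ v ≡ proj₂ (rsFrom 1 [] [] (word v))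
recQ≡rsFrom v with rsFrom 1 [] [] (word v)
... | _ , _ = refl

word≡tabulate : ∀ {n} (v : Permutation′ n) → word v ≡ tabulate (λ i → toℕ (v ⟨$⟩ʳ i))
word≡tabulate {n} v = map-tabulate {n = n} (λ i → i) (λ i → toℕ (v ⟨$⟩ʳ i))

length-word : ∀ {n} (v : Permutation′ n) → length (word v) ≡ n
length-word v rewrite word≡tabulate v = length-tabulate _

recQ-descent : ∀ {n} (v : Permutation′ n) j → suc j < n →
  (rowOf (suc j) (recQ v) <ᵇ rowOf (suc (suc j)) (recQ v)) ≡ (nth (word v) (suc j) <ᵇ nth (word v) j)
recQ-descent v j j+1<n rewrite recQ≡rsFrom v = begin
  rowOf (suc j) Q <ᵇ rowOf (suc (suc j)) Q
    ≡⟨ cong₂ _<ᵇ_ (rsFrom-rowOf xs 1 [] [] j refl [] (<-trans (n<1+n j) j+1<len))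
                  (rsFrom-rowOf xs 1 [] [] (suc j) refl [] j+1<len) ⟩
  nth (insertionRows [] xs) j <ᵇ nth (insertionRows [] xs) (suc j)
    ≡⟨ insertionRows-descent xs [] j [] j+1<len ⟩
  nth xs (suc j) <ᵇ nth xs j ∎
  where
  xs : List ℕ
  xs = word v
  Q : Tableau
  Q = proj₂ (rsFrom 1 [] [] xs)
  j+1<len : suc j < length xs
  j+1<len = subst (suc j <_) (sym (length-word v)) j+1<n

nth-tabulate : ∀ {n} (f : Fin n → ℕ) i → nth (tabulate f) i ≡ maybe f 0 (finOf n i)
nth-tabulate {zero}  f i       = refl
nth-tabulate {suc n} f zero    = refl
nth-tabulate {suc n} f (suc i) with finOf n i | nth-tabulate (f ∘ Fin.suc) i
... | nothing | eq = eq
... | just _  | eq = eq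

nth-word-inv : ∀ {n} (w : Permutation′ n) i → nth (word (inv w)) i ≡ invAt w (suc i)
nth-word-inv {n} w i rewrite word≡tabulate (inv w) = nth-tabulate {n} (λ j → toℕ (inv w ⟨$⟩ʳ j)) i

Des-recQ-inv : ∀ {n} (w : Permutation′ n) → Des n (recQ (inv w)) ≡ filter (T? ∘ inDL w) (oneTo (n ∸ 1))
Des-recQ-inv {zero}  w = refl
Des-recQ-inv {suc m} w = filter-cong _ (T? ∘ inDL w) (AllP.map⁺ (AllP.applyUpTo⁺₁ _ m descent))
  where
  descent : ∀ {j} → j < m →
    (rowOf (suc j) (recQ (inv w)) <ᵇ rowOf (suc (suc j)) (recQ (inv w))) ≡ inDL w (suc j)
  descent {j} j<m rewrite recQ-descent (inv w) j (s≤s j<m)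
                        | nth-word-inv w j | nth-word-inv w (suc j) = refl

interval : ℕ → ℕ → List ℕ
interval a zero    = []
interval a (suc m) = a ∷ interval (suc a) m

applyUpTo≡interval : ∀ f a m → (∀ i → f i ≡ a + i) → applyUpTo f m ≡ interval a m
applyUpTo≡interval f a zero    _     = refl
applyUpTo≡interval f a (suc m) f≗a+ = cong₂ _∷_ (trans (f≗a+ 0) (+-identityʳ a))
  (applyUpTo≡interval (f ∘ suc) (suc a) m (λ i → trans (f≗a+ (suc i)) (+-suc a i)))

oneTo≡interval : ∀ m → oneTo m ≡ interval 1 m
oneTo≡interval m = trans (map-upTo suc m) (applyUpTo≡interval suc 1 m (λ _ → refl))

interval-All> : ∀ {p} a m → p < a → All (p <_) (interval a m)
interval-All> a zero    _   = []
interval-All> a (suc m) p<a = p<a ∷ interval-All> (suc a) m (m<n⇒m<1+n p<a)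

depFrom-desFrom-suc : ∀ N p k ds → All (p <_) ds → p < N →
  depFrom k (desFrom N p ds) ≡ k + depFrom k (desFrom N (suc p) ds)
depFrom-desFrom-suc N p k []       _         p<N rewrite +-∸-assoc 1 p<N | *-suc k (N ∸ suc p) =
  +-assoc k _ _
depFrom-desFrom-suc N p k (a ∷ ds) (p<a ∷ _) _   rewrite +-∸-assoc 1 p<a | *-suc k (a ∸ suc p) =
  +-assoc k _ _

-- Block weights start at c (suc p), since c i ∸ c (suc p) counts the d-descents in [p + 1, i).
sum-cumulative≡depFrom : ∀ (d : ℕ → Bool) (c : ℕ → ℕ) →
  (∀ i → c (suc (suc i)) ≡ c (suc i) + (if d (suc i) then 1 else 0)) →
  ∀ p m → sum (map c (interval (suc p) (suc m)))
        ≡ depFrom (c (suc p)) (desFrom (suc p + m) p (filter (T? ∘ d) (interval (suc p) m)))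
sum-cumulative≡depFrom d c step p zero
  rewrite +-identityʳ (c (suc p)) | +-identityʳ (suc p) | m+n∸n≡m 1 p | *-identityʳ (c (suc p)) =
  sym (+-identityʳ (c (suc p)))
sum-cumulative≡depFrom d c step p (suc m) rewrite +-suc (suc p) m with d (suc p) | step p
... | true  | c₊ = begin
  c (suc p) + sum (map c (interval (suc (suc p)) (suc m)))
    ≡⟨ cong (c (suc p) +_) (sum-cumulative≡depFrom d c step (suc p) m) ⟩
  c (suc p) + depFrom (c (suc (suc p))) (desFrom N (suc p) F)
    ≡⟨ cong (λ k → c (suc p) + depFrom k (desFrom N (suc p) F)) (trans c₊ (+-comm _ 1)) ⟩
  c (suc p) + depFrom (suc (c (suc p))) (desFrom N (suc p) F)
    ≡⟨ cong (_+ depFrom (suc (c (suc p))) (desFrom N (suc p) F)) (sym singleton-block) ⟩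
  c (suc p) * (suc p ∸ p) + depFrom (suc (c (suc p))) (desFrom N (suc p) F) ∎
  where
  N : ℕ
  N = suc (suc p) + m
  F : List ℕ
  F = filter (T? ∘ d) (interval (suc (suc p)) m)
  singleton-block : c (suc p) * (suc p ∸ p) ≡ c (suc p)
  singleton-block = trans (cong (c (suc p) *_) (m+n∸n≡m 1 p)) (*-identityʳ _)
... | false | c₊ = begin
  c (suc p) + sum (map c (interval (suc (suc p)) (suc m)))
    ≡⟨ cong (c (suc p) +_) (sum-cumulative≡depFrom d c step (suc p) m) ⟩
  c (suc p) + depFrom (c (suc (suc p))) (desFrom N (suc p) F)
    ≡⟨ cong (λ k → c (suc p) + depFrom k (desFrom N (suc p) F)) (trans c₊ (+-identityʳ _)) ⟩
  c (suc p) + depFrom (c (suc p)) (desFrom N (suc p) F)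
    ≡⟨ sym (depFrom-desFrom-suc N p (c (suc p)) F F>p (m<n⇒m<1+n (m≤m+n (suc p) m))) ⟩
  depFrom (c (suc p)) (desFrom N p F) ∎
  where
  N : ℕ
  N = suc (suc p) + m
  F : List ℕ
  F = filter (T? ∘ d) (interval (suc (suc p)) m)
  F>p : All (p <_) F
  F>p = AllP.filter⁺ (T? ∘ d) (interval-All> (suc (suc p)) m (m<n⇒m<1+n (n<1+n p)))

charge≡depComp : ∀ {n} (w : Permutation′ n) →
  charge w ≡ depComp (desFrom n 0 (filter (T? ∘ inDL w) (oneTo (n ∸ 1))))
charge≡depComp {zero}  w = refl
charge≡depComp {suc m} w = begin
  sum (map (chargeAt w) (oneTo (suc m)))
    ≡⟨ cong (sum ∘ map (chargeAt w)) (oneTo≡interval (suc m)) ⟩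
  sum (map (chargeAt w) (interval 1 (suc m)))
    ≡⟨ sum-cumulative≡depFrom (inDL w) (chargeAt w) (λ _ → refl) 0 m ⟩
  depComp (desFrom (suc m) 0 (filter (T? ∘ inDL w) (interval 1 m)))
    ≡⟨ cong (depComp ∘ desFrom (suc m) 0 ∘ filter (T? ∘ inDL w)) (sym (oneTo≡interval m)) ⟩
  depComp (desFrom (suc m) 0 (filter (T? ∘ inDL w) (oneTo m))) ∎

mainTheorem12 : (n : ℕ) (w : Permutation′ n) → charge w ≡ depPerm (inv w)
mainTheorem12 n w = begin
  charge w
    ≡⟨ charge≡depComp w ⟩
  depComp (desFrom n 0 (filter (T? ∘ inDL w) (oneTo (n ∸ 1))))
    ≡⟨ cong (depComp ∘ desFrom n 0) (sym (Des-recQ-inv w)) ⟩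
  depComp (desFrom n 0 (Des n (recQ (inv w)))) ∎
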